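{- For all integers $1 \leq k \leq n$, \[ \sum_{\substack{\alpha \vDash n\\ \ell(\alpha) = k}} g^{\alpha} = \left\{ \begin{matrix} n \\ k \end{matrix} \right\}, \] where the sum is over all compositions $\alpha$ of $n$ with exactly $k$ parts and $\left\{ \begin{smallmatrix} n \\ k \end{smallmatrix} \right\}$ is the Stirling number of the second kind (the number of partitions of the set $\{1,\dots,n\}$ into $k$ nonempty blocks).
   Context: A composition $\alpha=(\alpha_1,\dots,\alpha_{\ell(\alpha)})$ of $n$ (written $\alpha \vDash n$) is a finite tuple of positive integers summing to $n$; $\ell(\alpha)$ is its number of parts. The diagram of $\alpha$ consists of left-justified rows of cells, row $i$ having $\alpha_i$ cells (rows indexed from the bottom, first row at the bottom). A standard immaculate tableau of shape $\alpha\vDash n$ is a filling of the diagram of $\alpha$ with the labels $1,2,\dots,n$, each used exactly once, such that the entries of the first column strictly increase from row $1$ to row $\ell(\alpha)$ and each row is increasing from left to right. $g^{\alpha}$ denotes the number of standard immaculate tableaux of shape $\alpha$. -}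

module Defs where

open import Data.Bool using (Bool; true; false; _∧_; _∨_; not)
open import Data.Nat using (ℕ; zero; suc; _+_; _<ᵇ_; _≡ᵇ_; _≤ᵇ_)
open import Data.List using (List; []; _∷_; map; concatMap; length; filter; upTo; concat; head)
open import Data.Bool.ListAction using (and; or)
open import Data.Nat.ListAction using (sum)
open import Data.Maybe using (Maybe; just; nothing)
open import Data.Vec using (Vec; []; _∷_; toList; allFin)
import Data.Vec as V
open import Data.Fin using (Fin; toℕ)
open import Data.Fin.Subset using (Subset)
open import Relation.Nullary.Decidable using (Dec; ⌊_⌋)
open import Data.Bool.Properties using (T?)

allLists : {A : Set} → ℕ → List A → List (List A)
allLists zero    xs = [] ∷ []
allLists (suc m) xs = concatMap (λ x → map (x ∷_) (allLists m xs)) xs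

allVecs : {A : Set} → (m : ℕ) → List A → List (Vec A m)
allVecs zero    xs = [] ∷ []
allVecs (suc m) xs = concatMap (λ x → map (x ∷_) (allVecs m xs)) xs

count : {A : Set} → (A → Bool) → List A → ℕ
count p xs = length (filter (λ x → T? (p x)) xs)

labels : ℕ → List ℕ
labels n = map suc (upTo n)

occ : ℕ → List ℕ → ℕ
occ x ys = count (λ y → x ≡ᵇ y) ys

increasing : List ℕ → Bool
increasing []           = true
increasing (x ∷ [])     = true
increasing (x ∷ y ∷ ys) = (x <ᵇ y) ∧ increasing (y ∷ ys)

allB : {A : Set} → (A → Bool) → List A → Bool
allB p xs = and (map p xs)

isComposition : ∀ {k} → ℕ → Vec ℕ k → Bool
isComposition n α = allB (λ a → 1 ≤ᵇ a) (toList α) ∧ (sum (toList α) ≡ᵇ n)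

-- candidate compositions of n with k parts (parts range over 1..n,
-- which covers every composition of n); each listed exactly once
compositionsOf : ℕ → (k : ℕ) → List (Vec ℕ k)
compositionsOf n k = filter (λ α → T? (isComposition n α)) (allVecs k (labels n))

-- A filling of the diagram of α = (α₁,…,α_k) is given by its rows
-- T = (row₁,…,row_k) (row 1 is the bottom row); row i is the list of
-- entries of row i read from left to right.

heads : ∀ {k} → Vec (List ℕ) k → List ℕ
heads [] = []
heads (([]) ∷ rs)     = 0 ∷ heads rs   -- never used for valid shapes
heads ((x ∷ _) ∷ rs)  = x ∷ heads rs

rowsHaveShape : ∀ {k} → Vec ℕ k → Vec (List ℕ) k → Bool
rowsHaveShape []       []       = true
rowsHaveShape (a ∷ α) (r ∷ rs) = (length r ≡ᵇ a) ∧ rowsHaveShape α rs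

isStandardImmaculate : ∀ {k} → ℕ → Vec ℕ k → Vec (List ℕ) k → Bool
isStandardImmaculate n α T =
  rowsHaveShape α T
  ∧ allB increasing (toList T)
  ∧ increasing (heads T)
  ∧ allB (λ x → occ x (concat (toList T)) ≡ᵇ 1) (labels n)
  ∧ allB (λ x → (1 ≤ᵇ x) ∧ (x ≤ᵇ n)) (concat (toList T))

allFillings : ∀ {k} → ℕ → Vec ℕ k → List (Vec (List ℕ) k)
allFillings n []       = [] ∷ []
allFillings n (a ∷ α) =
  concatMap (λ r → map (r ∷_) (allFillings n α)) (allLists a (labels n))

g : ∀ {k} → (n : ℕ) → Vec ℕ k → ℕ
g n α = count (isStandardImmaculate n α) (allFillings n α)

-- An (unordered)
-- partition is represented canonically by listing its k blocks
-- B₁,…,B_k in increasing order of their minimal elements.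

minElem : ∀ {n} → Subset n → Maybe ℕ
minElem {n} B = head (map toℕ (filter (λ i → T? (V.lookup B i)) (toList (allFin n))))

minsIncreasing : List (Maybe ℕ) → Bool
minsIncreasing []                         = true
minsIncreasing (_ ∷ [])                   = true
minsIncreasing (just x ∷ just y ∷ ms)     = (x <ᵇ y) ∧ minsIncreasing (just y ∷ ms)
minsIncreasing (_ ∷ _ ∷ _)                = false

nonempty : ∀ {n} → Subset n → Bool
nonempty B = or (toList B)

blocksContaining : ∀ {n k} → Fin n → Vec (Subset n) k → ℕ
blocksContaining i Bs = count (λ B → V.lookup B i) (toList Bs)

isSetPartition : ∀ {k} → (n : ℕ) → Vec (Subset n) k → Bool
isSetPartition n Bs =
  allB nonempty (toList Bs)
  ∧ allB (λ i → blocksContaining i Bs ≡ᵇ 1) (toList (allFin n))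
  ∧ minsIncreasing (map minElem (toList Bs))

allSubsets : (n : ℕ) → List (Subset n)
allSubsets n = allVecs n (true ∷ false ∷ [])

stirling2 : ℕ → ℕ → ℕ
stirling2 n k = count (isSetPartition n) (allVecs k (allSubsets n))

-- Read each row of a standard immaculate tableau as a set. Since rows increase, a row is recovered
-- from its set of entries; since every label is used once, the rows become k disjoint nonempty
-- blocks covering {1,…,n}; and the first-column condition says exactly that the blocks are listed
-- by increasing minima, the canonical listing of a set partition. Conversely the blocks of a set
-- partition, listed that way and written in increasing order, form a standard immaculate tableau
-- whose shape is the composition of block sizes. So the pairs (α, T) counted on the left are in
-- bijection with the partitions counted on the right.

module Submission where

open import Defs
open import Data.Bool using (Bool; true; false; T; _∧_)
open import Data.Bool.ListAction using (or)
open import Data.Bool.Properties using (T-∧; T-∨)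
open import Data.Empty using (⊥; ⊥-elim)
open import Data.Fin as Fin using (Fin; toℕ; fromℕ<)
open import Data.Fin.Properties using (toℕ-fromℕ<; toℕ<n; toℕ-injective)
open import Data.Fin.Subset using (Subset)
open import Data.List as List using (List; []; _∷_; _++_; map; length; filter; concat; concatMap; upTo; head)
open import Data.List.Properties
  using (length-map; length-++; length-filter; length-applyUpTo; map-∘; map-id-local;
         filter-++; filter-accept; filter-reject; filter-none; filter-some)
open import Data.List.Membership.Propositional using (_∈_; _∉_; find)
open import Data.List.Membership.Propositional.Properties
  using (∈-map⁺; ∈-map⁻; ∈-filter⁺; ∈-filter⁻; ∈-concatMap⁺; ∈-concatMap⁻;
         ∈-upTo⁺; ∈-upTo⁻; ∈-tabulate⁺)
open import Data.List.Membership.Propositional.Properties.WithK using (unique∧set⇒bag)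
open import Data.List.Relation.Binary.BagAndSetEquality using (∼bag⇒↭)
open import Data.List.Relation.Binary.Permutation.Propositional.Properties using (↭-length)
open import Data.List.Relation.Unary.All as All using (All; []; _∷_)
import Data.List.Relation.Unary.All.Properties as All
open import Data.List.Relation.Unary.All.Properties using (all⁺; all⁻)
open import Data.List.Relation.Unary.AllPairs as AllPairs using (AllPairs; []; _∷_)
import Data.List.Relation.Unary.AllPairs.Properties as AllPairs
open import Data.List.Relation.Unary.Any as Any using (here; there)
open import Data.List.Relation.Unary.Linked using (Linked; []; [-]; _∷_)
open import Data.List.Relation.Unary.Linked.Properties using (Linked⇒AllPairs; AllPairs⇒Linked)
open import Data.List.Relation.Unary.Unique.Propositional using (Unique)
import Data.List.Relation.Unary.Unique.Propositional.Properties as Unique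
open import Data.Maybe using (just)
open import Data.Nat using (ℕ; zero; suc; _+_; _≤_; _<_; z≤n; s≤s; s<s; _<ᵇ_; _≡ᵇ_; _≤ᵇ_)
open import Data.Nat.ListAction using (sum)
open import Data.Nat.Properties
  using (_≟_; <-trans; <-irrefl; <-asym; <⇒≢; 1+n≰n; suc-injective; module ≤-Reasoning;
         <ᵇ⇒<; <⇒<ᵇ; ≤ᵇ⇒≤; ≤⇒≤ᵇ; ≡ᵇ⇒≡; ≡⇒≡ᵇ)
open import Data.List.Membership.DecPropositional _≟_ using (_∈?_)
open import Data.Product using (∃; ∃₂; _×_; _,_; proj₁; proj₂; uncurry)
open import Data.Sum using (inj₁; inj₂)
open import Data.Unit using (tt)
open import Data.Vec as V using (Vec; []; _∷_; toList; tabulate; allFin; lookup)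
open import Data.Vec.Properties using (lookup∘tabulate; tabulate∘lookup; tabulate-cong; toList-map; length-toList)
import Data.Vec.Properties as Vec
open import Function using (_∘_; id; case_of_)
open import Function.Bundles using (_⇔_; mk⇔; Equivalence)
open import Relation.Nullary.Decidable using (T?; ⌊_⌋; yes; no; fromWitness; toWitness)
open import Relation.Binary.PropositionalEquality

open Equivalence using (to; from)

select : {A : Set} → (A → Bool) → List A → List A
select p = filter (λ x → T? (p x))

count-++ : {A : Set} (p : A → Bool) (xs ys : List A) → count p (xs ++ ys) ≡ count p xs + count p ys
count-++ p xs ys = trans (cong length (filter-++ _ xs ys)) (length-++ (select p xs))

count-map : {A B : Set} (p : B → Bool) (f : A → B) (xs : List A) → count p (map f xs) ≡ count (p ∘ f) xs
count-map p f [] = refl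
count-map p f (x ∷ xs) with p (f x)
... | true  = cong suc (count-map p f xs)
... | false = count-map p f xs

same-members⇒same-length : {A : Set} {xs ys : List A} → Unique xs → Unique ys →
  (∀ {z} → z ∈ xs ⇔ z ∈ ys) → length xs ≡ length ys
same-members⇒same-length u v eq = ↭-length (∼bag⇒↭ (unique∧set⇒bag u v eq))

-- The image of the selected xs under f and the selected ys are duplicate-free lists with the same
-- members, hence permutations of each other.
count-bijection : {A B : Set} (p : A → Bool) (q : B → Bool) (f : A → B) (h : B → A)
  {xs : List A} {ys : List B} → Unique xs → Unique ys →
  (∀ {x} → x ∈ select p xs → f x ∈ select q ys) →
  (∀ {y} → y ∈ select q ys → h y ∈ select p xs) →
  (∀ {x} → x ∈ select p xs → h (f x) ≡ x) →
  (∀ {y} → y ∈ select q ys → f (h y) ≡ y) →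
  count p xs ≡ count q ys
count-bijection p q f h {xs} {ys} u v fw bw hf fh =
  trans (sym (length-map f (select p xs)))
        (same-members⇒same-length image-unique (Unique.filter⁺ _ v) (mk⇔ image⊆ ⊆image))
  where
  image-unique : Unique (map f (select p xs))
  image-unique = Unique.map⁻ {f = h}
    (subst Unique (trans (sym (map-id-local (All.tabulate hf))) (map-∘ (select p xs)))
      (Unique.filter⁺ _ u))
  image⊆ : ∀ {z} → z ∈ map f (select p xs) → z ∈ select q ys
  image⊆ z∈ with ∈-map⁻ f z∈
  ... | x , x∈ , refl = fw x∈
  ⊆image : ∀ {y} → y ∈ select q ys → y ∈ map f (select p xs)
  ⊆image y∈ = subst (_∈ map f (select p xs)) (fh y∈) (∈-map⁺ f (bw y∈))

strictly-increasing-same-members⇒≡ : {xs ys : List ℕ} → AllPairs _<_ xs → AllPairs _<_ ys →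
  (∀ {z} → z ∈ xs ⇔ z ∈ ys) → xs ≡ ys
strictly-increasing-same-members⇒≡ {[]}     {[]}     _ _ _ = refl
strictly-increasing-same-members⇒≡ {[]}     {y ∷ _}  _ _ xs⇔ys with from xs⇔ys (here refl)
... | ()
strictly-increasing-same-members⇒≡ {x ∷ _}  {[]}     _ _ xs⇔ys with to xs⇔ys (here refl)
... | ()
strictly-increasing-same-members⇒≡ {x ∷ xs} {y ∷ ys} (x< ∷ sx) (y< ∷ sy) xs⇔ys =
  cong₂ _∷_ x≡y (strictly-increasing-same-members⇒≡ sx sy (mk⇔
    (λ z∈ → drop-head (to xs⇔ys (there z∈)) (subst (_< _) x≡y (All.lookup x< z∈)))
    (λ z∈ → drop-head (from xs⇔ys (there z∈)) (subst (_< _) (sym x≡y) (All.lookup y< z∈)))))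
  where
  drop-head : ∀ {w z ws} → z ∈ w ∷ ws → w < z → z ∈ ws
  drop-head (here refl) w<w = ⊥-elim (<-irrefl refl w<w)
  drop-head (there z∈)  _   = z∈
  x≡y : x ≡ y
  x≡y with to xs⇔ys (here refl) | from xs⇔ys (here refl)
  ... | here x≡y   | _          = x≡y
  ... | _          | here y≡x   = sym y≡x
  ... | there x∈ys | there y∈xs = ⊥-elim (<-asym (All.lookup x< y∈xs) (All.lookup y< x∈ys))

dependentProductWith : {A B C : Set} → (A → B → C) → List A → (A → List B) → List C
dependentProductWith c xs L = concatMap (λ x → map (c x) (L x)) xs

module _ {A B C : Set} (c : A → B → C) (L : A → List B) where

  ∈-dependentProductWith⁺ : ∀ {xs a b} → a ∈ xs → b ∈ L a → c a b ∈ dependentProductWith c xs L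
  ∈-dependentProductWith⁺ a∈ b∈ = ∈-concatMap⁺ _ (Any.map (λ { refl → ∈-map⁺ (c _) b∈ }) a∈)

  ∈-dependentProductWith⁻ : ∀ xs {z} → z ∈ dependentProductWith c xs L →
    ∃₂ λ a b → a ∈ xs × b ∈ L a × z ≡ c a b
  ∈-dependentProductWith⁻ xs z∈ with find (∈-concatMap⁻ _ {xs = xs} z∈)
  ... | a , a∈ , z∈' with ∈-map⁻ (c a) z∈'
  ...   | b , b∈ , refl = a , b , a∈ , b∈ , refl

  dependentProductWith-unique : (∀ {a a' b b'} → c a b ≡ c a' b' → a ≡ a' × b ≡ b') →
    ∀ {xs} → Unique xs → (∀ a → Unique (L a)) → Unique (dependentProductWith c xs L)
  dependentProductWith-unique c-inj []             uL = []
  dependentProductWith-unique c-inj {a ∷ xs} (a∉ ∷ u) uL =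
    Unique.++⁺ (Unique.map⁺ (proj₂ ∘ c-inj) (uL a)) (dependentProductWith-unique c-inj u uL) disjoint
    where
    disjoint : ∀ {z} → z ∈ map (c a) (L a) × z ∈ dependentProductWith c xs L → ⊥
    disjoint (z∈ , z∈') with ∈-map⁻ (c a) z∈ | ∈-dependentProductWith⁻ xs z∈'
    ... | _ , _ , refl | a' , _ , a'∈ , _ , e = All.lookup a∉ a'∈ (proj₁ (c-inj e))

sum-count-dependentProduct : {A B : Set} (p : A → B → Bool) (L : A → List B) (xs : List A) →
  sum (map (λ a → count (p a) (L a)) xs) ≡ count (uncurry p) (dependentProductWith _,_ xs L)
sum-count-dependentProduct p L []       = refl
sum-count-dependentProduct p L (a ∷ xs) = sym (begin
  count (uncurry p) (map (a ,_) (L a) ++ dependentProductWith _,_ xs L)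
    ≡⟨ count-++ (uncurry p) (map (a ,_) (L a)) _ ⟩
  count (uncurry p) (map (a ,_) (L a)) + count (uncurry p) (dependentProductWith _,_ xs L)
    ≡⟨ cong₂ _+_ (count-map (uncurry p) (a ,_) (L a)) (sym (sum-count-dependentProduct p L xs)) ⟩
  count (p a) (L a) + sum (map (λ a → count (p a) (L a)) xs) ∎)
  where open ≡-Reasoning

allVecs-unique : {A : Set} (m : ℕ) {xs : List A} → Unique xs → Unique (allVecs m xs)
allVecs-unique zero    u = [] ∷ []
allVecs-unique (suc m) u =
  dependentProductWith-unique _∷_ _ (λ { refl → refl , refl }) u (λ _ → allVecs-unique m u)

allLists-unique : {A : Set} (m : ℕ) {xs : List A} → Unique xs → Unique (allLists m xs)
allLists-unique zero    u = [] ∷ []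
allLists-unique (suc m) u =
  dependentProductWith-unique _∷_ _ (λ { refl → refl , refl }) u (λ _ → allLists-unique m u)

∈-allVecs⁺ : {A : Set} {m : ℕ} {xs : List A} (v : Vec A m) → All (_∈ xs) (toList v) → v ∈ allVecs m xs
∈-allVecs⁺ []      []         = here refl
∈-allVecs⁺ (x ∷ v) (x∈ ∷ v∈) = ∈-dependentProductWith⁺ _∷_ _ x∈ (∈-allVecs⁺ v v∈)

∈-allLists⁺ : {A : Set} {xs : List A} (l : List A) → All (_∈ xs) l → l ∈ allLists (length l) xs
∈-allLists⁺ []      []         = here refl
∈-allLists⁺ (x ∷ l) (x∈ ∷ l∈) = ∈-dependentProductWith⁺ _∷_ _ x∈ (∈-allLists⁺ l l∈)

labels-strict : (n : ℕ) → AllPairs _<_ (labels n)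
labels-strict n = AllPairs.map⁺ (AllPairs.applyUpTo⁺₁ _ n (λ i<j _ → s<s i<j))

labels-unique : (n : ℕ) → Unique (labels n)
labels-unique n = AllPairs.map <⇒≢ (labels-strict n)

∈-labels⁺ : {n m : ℕ} → m < n → suc m ∈ labels n
∈-labels⁺ m<n = ∈-map⁺ suc (∈-upTo⁺ m<n)

∈-labels⁻ : {n x : ℕ} → x ∈ labels n → ∃ λ m → m < n × x ≡ suc m
∈-labels⁻ x∈ with ∈-map⁻ suc x∈
... | m , m∈ , refl = m , ∈-upTo⁻ m∈ , refl

length-labels : (n : ℕ) → length (labels n) ≡ n
length-labels n = trans (length-map suc (upTo n)) (length-applyUpTo id n)

∈-labels⇔ : {n x : ℕ} → x ∈ labels n ⇔ (1 ≤ x × x ≤ n)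
∈-labels⇔ = mk⇔
  (λ x∈ → case ∈-labels⁻ x∈ of λ { (m , m<n , refl) → s≤s z≤n , m<n })
  (λ { (s≤s _ , x≤n) → ∈-labels⁺ x≤n })

allFillings-unique : (n : ℕ) {k : ℕ} (α : Vec ℕ k) → Unique (allFillings n α)
allFillings-unique n []      = [] ∷ []
allFillings-unique n (a ∷ α) =
  dependentProductWith-unique _∷_ _ (λ { refl → refl , refl })
    (allLists-unique a (labels-unique n)) (λ _ → allFillings-unique n α)

∈-allFillings⁺ : (n : ℕ) {k : ℕ} (rows : Vec (List ℕ) k) → All (All (_∈ labels n)) (toList rows) →
  rows ∈ allFillings n (V.map length rows)
∈-allFillings⁺ n []         []         = here refl
∈-allFillings⁺ n (r ∷ rows) (r∈ ∷ rs∈) =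
  ∈-dependentProductWith⁺ _∷_ _ (∈-allLists⁺ r r∈) (∈-allFillings⁺ n rows rs∈)

toList-tabulate : {A : Set} {n : ℕ} (f : Fin n → A) → toList (tabulate f) ≡ List.tabulate f
toList-tabulate {n = zero}  f = refl
toList-tabulate {n = suc n} f = cong (f Fin.zero ∷_) (toList-tabulate (f ∘ Fin.suc))

∈-toList-allFin : {n : ℕ} (i : Fin n) → i ∈ toList (allFin n)
∈-toList-allFin i = subst (i ∈_) (sym (toList-tabulate id)) (∈-tabulate⁺ i)

occ-∉ : {x : ℕ} {r : List ℕ} → x ∉ r → occ x r ≡ 0
occ-∉ {x} x∉ = cong length (filter-none (λ y → T? (x ≡ᵇ y))
  (All.tabulate λ {y} y∈ x≡ᵇy → x∉ (subst (_∈ _) (sym (≡ᵇ⇒≡ x y x≡ᵇy)) y∈)))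

occ-∷-≡ : {x : ℕ} (r : List ℕ) → occ x (x ∷ r) ≡ suc (occ x r)
occ-∷-≡ {x} r = cong length (filter-accept (λ y → T? (x ≡ᵇ y)) {x} {r} (≡⇒≡ᵇ x x refl))

occ-∷-≢ : {x y : ℕ} (r : List ℕ) → x ≢ y → occ x (y ∷ r) ≡ occ x r
occ-∷-≢ {x} {y} r x≢y = cong length (filter-reject (λ z → T? (x ≡ᵇ z)) {y} {r} (x≢y ∘ ≡ᵇ⇒≡ x y))

occ-pos : {x : ℕ} {r : List ℕ} → x ∈ r → 1 ≤ occ x r
occ-pos {x} x∈ = filter-some (λ y → T? (x ≡ᵇ y)) (Any.map (λ { refl → ≡⇒≡ᵇ x x refl }) x∈)

occ-∈ : {x : ℕ} {r : List ℕ} → Unique r → x ∈ r → occ x r ≡ 1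
occ-∈ {x} {x ∷ r} (x≢ ∷ _) (here refl) =
  trans (occ-∷-≡ {x} r) (cong suc (occ-∉ {x} {r} (λ x∈ → All.lookup x≢ x∈ refl)))
occ-∈ {x} {y ∷ r} (y≢ ∷ u) (there x∈) = trans (occ-∷-≢ {x} r (All.lookup y≢ x∈ ∘ sym)) (occ-∈ u x∈)

occ≡1⇒∈ : {x : ℕ} {r : List ℕ} → occ x r ≡ 1 → x ∈ r
occ≡1⇒∈ {x} {r} once with x ∈? r
... | yes x∈ = x∈
... | no  x∉ = case trans (sym once) (occ-∉ x∉) of λ ()

occ≡1⇒Unique : (r : List ℕ) → (∀ {x} → x ∈ r → occ x r ≡ 1) → Unique r
occ≡1⇒Unique []      _    = []
occ≡1⇒Unique (y ∷ r) once =
  All.tabulate (λ z∈ → λ { refl → y∉ z∈ }) ∷ occ≡1⇒Unique r (λ {x} x∈ →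
    trans (sym (occ-∷-≢ {x} r λ { refl → y∉ x∈ })) (once (there x∈)))
  where
  y∉ : y ∉ r
  y∉ y∈ = 1+n≰n (subst (2 ≤_) (trans (sym (occ-∷-≡ {y} r)) (once (here refl))) (s≤s (occ-pos {y} y∈)))

occ-concat : {x : ℕ} (p : List ℕ → Bool) → (∀ {r} → T (p r) ⇔ x ∈ r) →
  (rows : List (List ℕ)) → All Unique rows → occ x (concat rows) ≡ count p rows
occ-concat         p p⇔ []         []         = refl
occ-concat {x} p p⇔ (r ∷ rows) (ur ∷ urs) rewrite count-++ (x ≡ᵇ_) r (concat rows) with p r | p⇔ {r}
... | true  | r⇔ = cong₂ _+_ (occ-∈ ur (to r⇔ tt)) (occ-concat p p⇔ rows urs)
... | false | r⇔ = cong₂ _+_ (occ-∉ (from r⇔)) (occ-concat p p⇔ rows urs)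

T-injective : {a b : Bool} → T a ⇔ T b → a ≡ b
T-injective {false} {false} _ = refl
T-injective {false} {true}  e = ⊥-elim (from e tt)
T-injective {true}  {false} e = ⊥-elim (to e tt)
T-injective {true}  {true}  _ = refl

T-increasing⇒Linked : (xs : List ℕ) → T (increasing xs) → Linked _<_ xs
T-increasing⇒Linked []           _ = []
T-increasing⇒Linked (x ∷ [])     _ = [-]
T-increasing⇒Linked (x ∷ y ∷ ys) t =
  <ᵇ⇒< x y (proj₁ (to T-∧ t)) ∷ T-increasing⇒Linked (y ∷ ys) (proj₂ (to T-∧ t))

Linked⇒T-increasing : {xs : List ℕ} → Linked _<_ xs → T (increasing xs)
Linked⇒T-increasing []           = tt
Linked⇒T-increasing [-]          = tt
Linked⇒T-increasing (x<y ∷ rest) = from T-∧ (<⇒<ᵇ x<y , Linked⇒T-increasing rest)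

T-increasing⇔AllPairs : (xs : List ℕ) → T (increasing xs) ⇔ AllPairs _<_ xs
T-increasing⇔AllPairs xs = mk⇔
  (Linked⇒AllPairs <-trans ∘ T-increasing⇒Linked xs)
  (Linked⇒T-increasing ∘ AllPairs⇒Linked)

increasing-map-suc : (xs : List ℕ) → increasing (map suc xs) ≡ increasing xs
increasing-map-suc []           = refl
increasing-map-suc (x ∷ [])     = refl
increasing-map-suc (x ∷ y ∷ xs) = cong ((x <ᵇ y) ∧_) (increasing-map-suc (y ∷ xs))

minsIncreasing-map-just : (xs : List ℕ) → minsIncreasing (map just xs) ≡ increasing xs
minsIncreasing-map-just []           = refl
minsIncreasing-map-just (x ∷ [])     = refl
minsIncreasing-map-just (x ∷ y ∷ xs) = cong ((x <ᵇ y) ∧_) (minsIncreasing-map-just (y ∷ xs))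

T-or⇔∃-lookup : {m : ℕ} (v : Vec Bool m) → T (or (toList v)) ⇔ ∃ λ i → T (lookup v i)
T-or⇔∃-lookup []      = mk⇔ (λ ()) (λ ())
T-or⇔∃-lookup (b ∷ v) = mk⇔
  (λ t → case to T-∨ t of λ { (inj₁ tb) → Fin.zero , tb
                            ; (inj₂ tv) → let i , ti = to (T-or⇔∃-lookup v) tv in Fin.suc i , ti })
  (λ { (Fin.zero , tb)  → from T-∨ (inj₁ tb)
      ; (Fin.suc i , ti) → from T-∨ (inj₂ (from (T-or⇔∃-lookup v) (i , ti))) })

T-inRange⇔ : {n x : ℕ} → T ((1 ≤ᵇ x) ∧ (x ≤ᵇ n)) ⇔ x ∈ labels n
T-inRange⇔ {n} {x} = mk⇔
  (λ t → let 1≤x , x≤n = to T-∧ t in from ∈-labels⇔ (≤ᵇ⇒≤ 1 x 1≤x , ≤ᵇ⇒≤ x n x≤n))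
  (λ x∈ → let 1≤x , x≤n = to ∈-labels⇔ x∈ in from T-∧ (≤⇒≤ᵇ 1≤x , ≤⇒≤ᵇ x≤n))

T-isComposition⇔ : {k : ℕ} (n : ℕ) (α : Vec ℕ k) →
  T (isComposition n α) ⇔ (All (1 ≤_) (toList α) × sum (toList α) ≡ n)
T-isComposition⇔ n α = mk⇔
  (λ t → let pos , total = to T-∧ t in
    All.map (≤ᵇ⇒≤ 1 _) (all⁺ _ (toList α) pos) , ≡ᵇ⇒≡ _ n total)
  (λ { (pos , total) → from T-∧ (all⁻ _ (All.map ≤⇒≤ᵇ pos) , ≡⇒≡ᵇ _ n total) })

∈-compositionsOf⇒positive : {n k : ℕ} {α : Vec ℕ k} → α ∈ compositionsOf n k → All (1 ≤_) (toList α)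
∈-compositionsOf⇒positive {n} {k} {α} α∈ =
  proj₁ (to (T-isComposition⇔ n α)
    (proj₂ (∈-filter⁻ (λ β → T? (isComposition n β)) {xs = allVecs k (labels n)} α∈)))

T-rowsHaveShape⇔ : {k : ℕ} (α : Vec ℕ k) (rows : Vec (List ℕ) k) →
  T (rowsHaveShape α rows) ⇔ α ≡ V.map length rows
T-rowsHaveShape⇔ []      []         = mk⇔ (λ _ → refl) (λ _ → tt)
T-rowsHaveShape⇔ (a ∷ α) (r ∷ rows) = mk⇔
  (λ t → let a≡ , α≡ = to T-∧ t in cong₂ _∷_ (sym (≡ᵇ⇒≡ _ a a≡)) (to (T-rowsHaveShape⇔ α rows) α≡))
  (λ { refl → from T-∧ (≡⇒≡ᵇ (length r) _ refl , from (T-rowsHaveShape⇔ α rows) refl) })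

record IsStandardImmaculate (n : ℕ) {k : ℕ} (α : Vec ℕ k) (rows : Vec (List ℕ) k) : Set where
  field
    shape             : α ≡ V.map length rows
    rows-increasing   : All (AllPairs _<_) (toList rows)
    column-increasing : T (increasing (heads rows))
    labels-once       : All (λ x → occ x (concat (toList rows)) ≡ 1) (labels n)
    entries-labels    : All (_∈ labels n) (concat (toList rows))

T-isStandardImmaculate⇔ : (n : ℕ) {k : ℕ} (α : Vec ℕ k) (rows : Vec (List ℕ) k) →
  T (isStandardImmaculate n α rows) ⇔ IsStandardImmaculate n α rows
T-isStandardImmaculate⇔ n α rows = mk⇔
  (λ t → let sh , t₁ = to T-∧ t ; inc , t₂ = to T-∧ t₁ ; col , t₃ = to T-∧ t₂ ; once , range = to T-∧ t₃ in
    record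
      { shape             = to (T-rowsHaveShape⇔ α rows) sh
      ; rows-increasing   = All.map (to (T-increasing⇔AllPairs _)) (all⁺ _ (toList rows) inc)
      ; column-increasing = col
      ; labels-once       = All.map (≡ᵇ⇒≡ _ 1) (all⁺ _ (labels n) once)
      ; entries-labels    = All.map (to T-inRange⇔) (all⁺ _ (concat (toList rows)) range)
      })
  (λ sit → let open IsStandardImmaculate sit in
    from T-∧ (from (T-rowsHaveShape⇔ α rows) shape ,
    from T-∧ (all⁻ _ (All.map (from (T-increasing⇔AllPairs _)) rows-increasing) ,
    from T-∧ (column-increasing ,
    from T-∧ (all⁻ _ (All.map (≡⇒≡ᵇ _ 1) labels-once) ,
              all⁻ _ (All.map (from T-inRange⇔) entries-labels))))))

record IsSetPartition (n : ℕ) {k : ℕ} (Bs : Vec (Subset n) k) : Set where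
  field
    blocks-nonempty   : All (T ∘ nonempty) (toList Bs)
    covered-once      : ∀ i → blocksContaining i Bs ≡ 1
    minima-increasing : T (minsIncreasing (map minElem (toList Bs)))

T-isSetPartition⇔ : (n : ℕ) {k : ℕ} (Bs : Vec (Subset n) k) → T (isSetPartition n Bs) ⇔ IsSetPartition n Bs
T-isSetPartition⇔ n Bs = mk⇔
  (λ t → let ne , t₁ = to T-∧ t ; once , mins = to T-∧ t₁ in
    record
      { blocks-nonempty   = all⁺ _ (toList Bs) ne
      ; covered-once      = λ i → ≡ᵇ⇒≡ _ 1 (All.lookup (all⁺ _ (toList (allFin n)) once) (∈-toList-allFin i))
      ; minima-increasing = mins
      })
  (λ sp → let open IsSetPartition sp in
    from T-∧ (all⁻ _ blocks-nonempty ,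
    from T-∧ (all⁻ _ {toList (allFin n)} (All.tabulate (λ {i} _ → ≡⇒≡ᵇ _ 1 (covered-once i))) ,
              minima-increasing)))

sum-lengths : {k : ℕ} (rows : Vec (List ℕ) k) → sum (toList (V.map length rows)) ≡ length (concat (toList rows))
sum-lengths []         = refl
sum-lengths (r ∷ rows) = trans (cong (length r +_) (sum-lengths rows)) (sym (length-++ r))

size-standardImmaculate : {n k : ℕ} {α : Vec ℕ k} {rows : Vec (List ℕ) k} →
  IsStandardImmaculate n α rows → sum (toList α) ≡ n
size-standardImmaculate {n} {α = α} {rows} sit = begin
  sum (toList α)                        ≡⟨ cong (sum ∘ toList) shape ⟩
  sum (toList (V.map length rows))      ≡⟨ sum-lengths rows ⟩
  length (concat (toList rows))         ≡⟨ same-members⇒same-length entries-unique (labels-unique n) (mk⇔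
                                             (All.lookup entries-labels)
                                             (λ x∈ → occ≡1⇒∈ (All.lookup labels-once x∈))) ⟩
  length (labels n)                     ≡⟨ length-labels n ⟩
  n                                     ∎
  where
  open IsStandardImmaculate sit
  open ≡-Reasoning
  entries-unique : Unique (concat (toList rows))
  entries-unique = occ≡1⇒Unique _ (All.lookup labels-once ∘ All.lookup entries-labels)

module Blocks (n : ℕ) where

  label : Fin n → ℕ
  label i = suc (toℕ i)

  label∈labels : (i : Fin n) → label i ∈ labels n
  label∈labels i = ∈-labels⁺ (toℕ<n i)

  label-surjective : {x : ℕ} → x ∈ labels n → ∃ λ i → label i ≡ x
  label-surjective x∈ with ∈-labels⁻ x∈
  ... | m , m<n , refl = fromℕ< m<n , cong suc (toℕ-fromℕ< m<n)

  -- Chosen so that minElem B is head (members B) by definition.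
  members : Subset n → List ℕ
  members B = map toℕ (filter (λ i → T? (lookup B i)) (toList (allFin n)))

  toRow : Subset n → List ℕ
  toRow B = map suc (members B)

  toBlock : List ℕ → Subset n
  toBlock r = tabulate (λ i → ⌊ label i ∈? r ⌋)

  toRows : {m : ℕ} → Vec (Subset n) m → Vec (List ℕ) m
  toRows = V.map toRow

  toBlocks : {m : ℕ} → Vec (List ℕ) m → Vec (Subset n) m
  toBlocks = V.map toBlock

  T-lookup-toBlock : (r : List ℕ) (i : Fin n) → T (lookup (toBlock r) i) ⇔ label i ∈ r
  T-lookup-toBlock r i rewrite lookup∘tabulate (λ i → ⌊ label i ∈? r ⌋) i = mk⇔ toWitness fromWitness

  ∈-members⁺ : (B : Subset n) {i : Fin n} → T (lookup B i) → toℕ i ∈ members B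
  ∈-members⁺ B {i} t = ∈-map⁺ toℕ (∈-filter⁺ (λ j → T? (lookup B j)) (∈-toList-allFin i) t)

  ∈-toRow⁺ : (B : Subset n) {i : Fin n} → T (lookup B i) → label i ∈ toRow B
  ∈-toRow⁺ B = ∈-map⁺ suc ∘ ∈-members⁺ B

  ∈-toRow⁻ : (B : Subset n) {x : ℕ} → x ∈ toRow B → ∃ λ i → T (lookup B i) × x ≡ label i
  ∈-toRow⁻ B x∈ with ∈-map⁻ suc x∈
  ... | m , m∈ , refl with ∈-map⁻ toℕ m∈
  ...   | i , i∈ , refl = i , proj₂ (∈-filter⁻ (λ j → T? (lookup B j)) {xs = toList (allFin n)} i∈) , refl

  toRow-strict : (B : Subset n) → AllPairs _<_ (toRow B)
  toRow-strict B = AllPairs.map⁺ (AllPairs.map⁺ (AllPairs.filter⁺ _ allFin-strict))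
    where
    allFin-strict : AllPairs (λ i j → label i < label j) (toList (allFin n))
    allFin-strict = subst (AllPairs _) (sym (toList-tabulate id)) (AllPairs.tabulate⁺-< s<s)

  toRow⊆labels : (B : Subset n) → All (_∈ labels n) (toRow B)
  toRow⊆labels B = All.tabulate λ x∈ → case ∈-toRow⁻ B x∈ of λ { (i , _ , refl) → label∈labels i }

  length-toRow : (B : Subset n) → length (toRow B) ≤ n
  length-toRow B = begin
    length (toRow B)            ≡⟨ length-map suc (members B) ⟩
    length (members B)          ≡⟨ length-map toℕ selected ⟩
    length selected             ≤⟨ length-filter _ (toList (allFin n)) ⟩
    length (toList (allFin n))  ≡⟨ length-toList (allFin n) ⟩
    n                           ∎
    where
    open ≤-Reasoning
    selected : List (Fin n)
    selected = filter (λ i → T? (lookup B i)) (toList (allFin n))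

  toRow-toBlock : {r : List ℕ} → AllPairs _<_ r → All (_∈ labels n) r → toRow (toBlock r) ≡ r
  toRow-toBlock {r} r-strict r⊆labels = strictly-increasing-same-members⇒≡ (toRow-strict (toBlock r)) r-strict (mk⇔
    (λ x∈ → case ∈-toRow⁻ (toBlock r) x∈ of λ { (i , ti , refl) → to (T-lookup-toBlock r i) ti })
    (λ x∈ → case label-surjective (All.lookup r⊆labels x∈) of λ { (i , refl) →
      ∈-toRow⁺ (toBlock r) (from (T-lookup-toBlock r i) x∈) }))

  toBlock-toRow : (B : Subset n) → toBlock (toRow B) ≡ B
  toBlock-toRow B = trans (tabulate-cong same-entries) (tabulate∘lookup B)
    where
    same-entries : (i : Fin n) → ⌊ label i ∈? toRow B ⌋ ≡ lookup B i
    same-entries i = T-injective (mk⇔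
      (λ t → case ∈-toRow⁻ B (toWitness t) of λ { (j , tj , e) →
        subst (T ∘ lookup B) (sym (toℕ-injective (suc-injective e))) tj })
      (fromWitness ∘ ∈-toRow⁺ B))

  members-nonempty : (B : Subset n) → T (nonempty B) → ∃₂ λ m ms → members B ≡ m ∷ ms
  members-nonempty B ne = ∈⇒∷ (∈-members⁺ B (proj₂ (to (T-or⇔∃-lookup B) ne)))
    where
    ∈⇒∷ : {x : ℕ} {xs : List ℕ} → x ∈ xs → ∃₂ λ y ys → xs ≡ y ∷ ys
    ∈⇒∷ {xs = y ∷ ys} _ = y , ys , refl

  length-toRow∈labels : (B : Subset n) → T (nonempty B) → length (toRow B) ∈ labels n
  length-toRow∈labels B ne with members-nonempty B ne
  ... | m , ms , B≡m∷ms =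
    from ∈-labels⇔ (subst (λ l → 1 ≤ length (map suc l)) (sym B≡m∷ms) (s≤s z≤n) , length-toRow B)

  toBlock-nonempty : {y : ℕ} {r : List ℕ} → y ∈ labels n → T (nonempty (toBlock (y ∷ r)))
  toBlock-nonempty {y} {r} y∈ with label-surjective y∈
  ... | i , refl = from (T-or⇔∃-lookup (toBlock (y ∷ r))) (i , from (T-lookup-toBlock (y ∷ r) i) (here refl))

  heads-toRows : {m : ℕ} (Bs : Vec (Subset n) m) → All (T ∘ nonempty) (toList Bs) →
    ∃ λ ms → heads (toRows Bs) ≡ map suc ms × map minElem (toList Bs) ≡ map just ms
  heads-toRows []       []         = [] , refl , refl
  heads-toRows (B ∷ Bs) (ne ∷ nes) with members-nonempty B ne | heads-toRows Bs nes
  ... | m , ms , B≡m∷ms | ms′ , heads≡ , minima≡ =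
    m ∷ ms′ ,
    trans (cong (λ r → heads (map suc r ∷ toRows Bs)) B≡m∷ms) (cong (suc m ∷_) heads≡) ,
    cong₂ _∷_ (cong head B≡m∷ms) minima≡

  increasing-heads-toRows : {m : ℕ} (Bs : Vec (Subset n) m) → All (T ∘ nonempty) (toList Bs) →
    increasing (heads (toRows Bs)) ≡ minsIncreasing (map minElem (toList Bs))
  increasing-heads-toRows Bs nes with heads-toRows Bs nes
  ... | ms , heads≡ , minima≡ = begin
    increasing (heads (toRows Bs))            ≡⟨ cong increasing heads≡ ⟩
    increasing (map suc ms)                   ≡⟨ increasing-map-suc ms ⟩
    increasing ms                             ≡⟨ minsIncreasing-map-just ms ⟨
    minsIncreasing (map just ms)              ≡⟨ cong minsIncreasing minima≡ ⟨
    minsIncreasing (map minElem (toList Bs))  ∎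
    where open ≡-Reasoning

  blocksContaining-toBlocks : {m : ℕ} (i : Fin n) (rows : Vec (List ℕ) m) → All Unique (toList rows) →
    blocksContaining i (toBlocks rows) ≡ occ (label i) (concat (toList rows))
  blocksContaining-toBlocks i rows unique-rows = begin
    count (λ B → lookup B i) (toList (toBlocks rows))     ≡⟨ cong (count _) (toList-map toBlock rows) ⟩
    count (λ B → lookup B i) (map toBlock (toList rows))  ≡⟨ count-map _ toBlock (toList rows) ⟩
    count (λ r → lookup (toBlock r) i) (toList rows)      ≡⟨ occ-concat _ (T-lookup-toBlock _ i) _ unique-rows ⟨
    occ (label i) (concat (toList rows))                  ∎
    where open ≡-Reasoning

  All-toRows⁺ : {P : List ℕ → Set} {m : ℕ} (Bs : Vec (Subset n) m) → All (P ∘ toRow) (toList Bs) →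
    All P (toList (toRows Bs))
  All-toRows⁺ Bs = subst (All _) (sym (toList-map toRow Bs)) ∘ All.map⁺

  toRows-toBlocks : {m : ℕ} (rows : Vec (List ℕ) m) → All (AllPairs _<_) (toList rows) →
    All (All (_∈ labels n)) (toList rows) → toRows (toBlocks rows) ≡ rows
  toRows-toBlocks []         []               []                 = refl
  toRows-toBlocks (r ∷ rows) (r-strict ∷ inc) (r⊆labels ∷ range) =
    cong₂ _∷_ (toRow-toBlock r-strict r⊆labels) (toRows-toBlocks rows inc range)

  toBlocks-toRows : {m : ℕ} (Bs : Vec (Subset n) m) → toBlocks (toRows Bs) ≡ Bs
  toBlocks-toRows Bs = trans (sym (Vec.map-∘ toBlock toRow Bs)) (trans (Vec.map-cong toBlock-toRow Bs) (Vec.map-id Bs))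

module Correspondence (n k : ℕ) where
  open Blocks n

  toBlocks-isSetPartition : {α : Vec ℕ k} {rows : Vec (List ℕ) k} → α ∈ compositionsOf n k →
    IsStandardImmaculate n α rows → IsSetPartition n (toBlocks rows)
  toBlocks-isSetPartition {α} {rows} α∈ sit = record
    { blocks-nonempty   = blocks-nonempty
    ; covered-once      = λ i →
        trans (blocksContaining-toBlocks i rows (All.map (AllPairs.map <⇒≢) rows-increasing))
              (All.lookup labels-once (label∈labels i))
    ; minima-increasing =
        subst T (increasing-heads-toRows _ blocks-nonempty)
          (subst (T ∘ increasing ∘ heads) (sym (toRows-toBlocks rows rows-increasing rows⊆labels)) column-increasing)
    }
    where
    open IsStandardImmaculate sit
    rows⊆labels : All (All (_∈ labels n)) (toList rows)
    rows⊆labels = All.concat⁻ entries-labels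
    rows-nonempty : All ((1 ≤_) ∘ length) (toList rows)
    rows-nonempty = All.map⁻ (subst (All (1 ≤_)) (trans (cong toList shape) (toList-map length rows))
      (∈-compositionsOf⇒positive α∈))
    block-nonempty : {r : List ℕ} → 1 ≤ length r × All (_∈ labels n) r → T (nonempty (toBlock r))
    block-nonempty {_ ∷ _} (_ , y∈ ∷ _) = toBlock-nonempty y∈
    blocks-nonempty : All (T ∘ nonempty) (toList (toBlocks rows))
    blocks-nonempty = subst (All _) (sym (toList-map toBlock rows))
      (All.map⁺ (All.zipWith block-nonempty (rows-nonempty , rows⊆labels)))

  toRows-isStandardImmaculate : {Bs : Vec (Subset n) k} → IsSetPartition n Bs →
    IsStandardImmaculate n (V.map length (toRows Bs)) (toRows Bs)
  toRows-isStandardImmaculate {Bs} sp = record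
    { shape             = refl
    ; rows-increasing   = rows-increasing
    ; column-increasing = subst T (sym (increasing-heads-toRows Bs blocks-nonempty)) minima-increasing
    ; labels-once       = All.tabulate λ x∈ → case label-surjective x∈ of λ { (i , refl) → once i }
    ; entries-labels    = All.concat⁺ (All-toRows⁺ Bs (All.universal toRow⊆labels _))
    }
    where
    open IsSetPartition sp
    open ≡-Reasoning
    rows : Vec (List ℕ) k
    rows = toRows Bs
    rows-increasing : All (AllPairs _<_) (toList rows)
    rows-increasing = All-toRows⁺ Bs (All.universal toRow-strict _)
    rows-unique : All Unique (toList rows)
    rows-unique = All.map (AllPairs.map <⇒≢) rows-increasing
    once : (i : Fin n) → occ (label i) (concat (toList rows)) ≡ 1
    once i = begin
      occ (label i) (concat (toList rows))  ≡⟨ blocksContaining-toBlocks i rows rows-unique ⟨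
      blocksContaining i (toBlocks rows)    ≡⟨ cong (blocksContaining i) (toBlocks-toRows Bs) ⟩
      blocksContaining i Bs                 ≡⟨ covered-once i ⟩
      1                                     ∎

  toRows-composition : {Bs : Vec (Subset n) k} → IsSetPartition n Bs → V.map length (toRows Bs) ∈ compositionsOf n k
  toRows-composition {Bs} sp = ∈-filter⁺ (λ β → T? (isComposition n β)) (∈-allVecs⁺ _ parts⊆labels)
    (from (T-isComposition⇔ n _) (All.map (proj₁ ∘ to ∈-labels⇔) parts⊆labels ,
                                  size-standardImmaculate (toRows-isStandardImmaculate sp)))
    where
    parts⊆labels : All (_∈ labels n) (toList (V.map length (toRows Bs)))
    parts⊆labels = subst (All _) (sym (toList-map length (toRows Bs)))
      (All.map⁺ (All-toRows⁺ Bs (All.map (λ {B} → length-toRow∈labels B) (IsSetPartition.blocks-nonempty sp))))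

  tableaux : List (Vec ℕ k × Vec (List ℕ) k)
  tableaux = dependentProductWith _,_ (compositionsOf n k) (allFillings n)

  isTableau : Vec ℕ k × Vec (List ℕ) k → Bool
  isTableau = uncurry (isStandardImmaculate n)

  partitions : List (Vec (Subset n) k)
  partitions = allVecs k (allSubsets n)

  toPartition : Vec ℕ k × Vec (List ℕ) k → Vec (Subset n) k
  toPartition (_ , rows) = toBlocks rows

  toTableau : Vec (Subset n) k → Vec ℕ k × Vec (List ℕ) k
  toTableau Bs = V.map length (toRows Bs) , toRows Bs

  tableaux-unique : Unique tableaux
  tableaux-unique = dependentProductWith-unique _,_ (allFillings n) (λ { refl → refl , refl })
    (Unique.filter⁺ _ (allVecs-unique k (labels-unique n))) (allFillings-unique n)

  partitions-unique : Unique partitions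
  partitions-unique = allVecs-unique k (allVecs-unique n bools-unique)
    where
    bools-unique : Unique (true ∷ false ∷ [])
    bools-unique = ((λ ()) ∷ []) ∷ [] ∷ []

  ∈-tableaux⁻ : {z : Vec ℕ k × Vec (List ℕ) k} → z ∈ select isTableau tableaux →
    ∃₂ λ α rows → z ≡ (α , rows) × α ∈ compositionsOf n k × IsStandardImmaculate n α rows
  ∈-tableaux⁻ z∈ with ∈-filter⁻ (λ z → T? (isTableau z)) {xs = tableaux} z∈
  ... | z∈′ , t with ∈-dependentProductWith⁻ _,_ (allFillings n) (compositionsOf n k) z∈′
  ...   | α , rows , α∈ , _ , refl = α , rows , refl , α∈ , to (T-isStandardImmaculate⇔ n α rows) t

  toPartition-∈ : {z : Vec ℕ k × Vec (List ℕ) k} → z ∈ select isTableau tableaux →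
    toPartition z ∈ select (isSetPartition n) partitions
  toPartition-∈ z∈ with ∈-tableaux⁻ z∈
  ... | α , rows , refl , α∈ , sit =
    ∈-filter⁺ (λ Bs → T? (isSetPartition n Bs)) (∈-allVecs⁺ _ (All.universal ∈-allSubsets _))
      (from (T-isSetPartition⇔ n _) (toBlocks-isSetPartition α∈ sit))
    where
    ∈-allSubsets : (B : Subset n) → B ∈ allSubsets n
    ∈-allSubsets B = ∈-allVecs⁺ B (All.universal (λ { true → here refl ; false → there (here refl) }) _)

  toTableau-∈ : {Bs : Vec (Subset n) k} → Bs ∈ select (isSetPartition n) partitions →
    toTableau Bs ∈ select isTableau tableaux
  toTableau-∈ {Bs} Bs∈ =
    ∈-filter⁺ (λ z → T? (isTableau z))
      (∈-dependentProductWith⁺ _,_ (allFillings n) (toRows-composition sp)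
        (∈-allFillings⁺ n _ (All.concat⁻ (IsStandardImmaculate.entries-labels sit))))
      (from (T-isStandardImmaculate⇔ n _ _) sit)
    where
    sp : IsSetPartition n Bs
    sp = to (T-isSetPartition⇔ n Bs) (proj₂ (∈-filter⁻ (λ Bs → T? (isSetPartition n Bs)) {xs = partitions} Bs∈))
    sit : IsStandardImmaculate n (V.map length (toRows Bs)) (toRows Bs)
    sit = toRows-isStandardImmaculate sp

  toTableau∘toPartition : {z : Vec ℕ k × Vec (List ℕ) k} → z ∈ select isTableau tableaux →
    toTableau (toPartition z) ≡ z
  toTableau∘toPartition z∈ with ∈-tableaux⁻ z∈
  ... | α , rows , refl , _ , sit = cong₂ _,_ (trans (cong (V.map length) rows≡) (sym shape)) rows≡
    where
    open IsStandardImmaculate sit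
    rows≡ : toRows (toBlocks rows) ≡ rows
    rows≡ = toRows-toBlocks rows rows-increasing (All.concat⁻ entries-labels)

theorem3p1 : (n k : ℕ) → 1 ≤ k → k ≤ n →
    sum (map (g n) (compositionsOf n k)) ≡ stirling2 n k
theorem3p1 n k _ _ = begin
  sum (map (g n) (compositionsOf n k))
    ≡⟨ sum-count-dependentProduct (isStandardImmaculate n) (allFillings n) (compositionsOf n k) ⟩
  count isTableau tableaux
    ≡⟨ count-bijection isTableau (isSetPartition n) toPartition toTableau tableaux-unique partitions-unique
         toPartition-∈ toTableau-∈ toTableau∘toPartition (λ _ → toBlocks-toRows _) ⟩
  stirling2 n k ∎
  where
  open Correspondence n k
  open Blocks n using (toBlocks-toRows)
  open ≡-Reasoning
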